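{- Let $(S,A,\to)$ be any labelled transition system. For every state $s$ of its projection closure, every $\varphi\in{\it HML}$ and every $n\in\mathbb{N}$: $\pi_n(s)\models\varphi$ if and only if $s\models cut_n(\varphi)$.
   Context: A labelled transition system consists of a set $S$ of states, a set $A$ of actions and transitions $s\xrightarrow{a}s'$. For each $n\in\mathbb{N}$ there is a projection operator $\pi_n$; the projection closure has as states all expressions obtained from states of $S$ by finitely many applications of the $\pi_n$, with the original transitions together with those given by the rule: if $x\xrightarrow{a}x'$ then $\pi_{n+1}(x)\xrightarrow{a}\pi_n(x')$ (these are the only transitions of projected states; $\pi_0(x)$ has none). Hennessy-Milner logic ${\it HML}$ has formulas $\varphi ::= {\sf T} \mid \bigwedge_{i\in I}\varphi_i \mid \langle a\rangle\varphi \mid \neg\varphi$ ($a\in A$, $I$ arbitrary index set) with $s\models{\sf T}$; $s\models\bigwedge_{i\in I}\varphi_i$ iff $s\models\varphi_i$ for all $i$; $s\models\langle a\rangle\varphi$ iff some $s'$ with $s\xrightarrow{a}s'$ satisfies $\varphi$; $s\models\neg\varphi$ iff $s\not\models\varphi$. ${\sf F}$ denotes a formula satisfied by no state (e.g. $\neg{\sf T}$). The functions $cut_n$ are defined by $cut_n({\sf T})={\sf T}$, $cut_0(\langle a\rangle\varphi)={\sf F}$, $cut_{n+1}(\langle a\rangle\varphi)=\langle a\rangle cut_n(\varphi)$, $cut_n(\bigwedge_{i\in I}\varphi_i)=\bigwedge_{i\in I}cut_n(\varphi_i)$, $cut_n(\neg\varphi)=\neg cut_n(\varphi)$. -}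

module Defs where

open import Level using (Level; _⊔_; suc)
open import Data.Nat using (ℕ; zero) renaming (suc to 1+)
open import Data.Product using (Σ; _×_)
open import Relation.Nullary using (¬_)

record LTS (ℓ : Level) : Set (suc ℓ) where
  field
    State  : Set ℓ
    Action : Set ℓ
    _⟶[_]_ : State → Action → State → Set ℓ

data HML {ℓ : Level} (ι : Level) (A : Set ℓ) : Set (ℓ ⊔ suc ι) where
  T    : HML ι A
  ⋀    : (I : Set ι) → (I → HML ι A) → HML ι A
  ⟨_⟩_ : A → HML ι A → HML ι A
  ¬'   : HML ι A → HML ι A

F : ∀ {ℓ ι} {A : Set ℓ} → HML ι A
F = ¬' T

cut : ∀ {ℓ ι} {A : Set ℓ} → ℕ → HML ι A → HML ι A
cut n      T         = T
cut zero   (⟨ a ⟩ φ) = F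
cut (1+ n) (⟨ a ⟩ φ) = ⟨ a ⟩ cut n φ
cut n      (⋀ I φs)  = ⋀ I (λ i → cut n (φs i))
cut n      (¬' φ)    = ¬' (cut n φ)

module ProjectionClosure {ℓ : Level} (L : LTS ℓ) where
  open LTS L

  data PState : Set ℓ where
    ⌜_⌝ : State → PState
    π   : ℕ → PState → PState

  data _⇒[_]_ : PState → Action → PState → Set ℓ where
    base : ∀ {s a s'} → s ⟶[ a ] s' → ⌜ s ⌝ ⇒[ a ] ⌜ s' ⌝
    proj : ∀ {n x a x'} → x ⇒[ a ] x' → π (1+ n) x ⇒[ a ] π n x'

  _⊨_ : ∀ {ι} → PState → HML ι Action → Set (ℓ ⊔ ι)
  x ⊨ T        = Level.Lift _ Data.Unit.⊤ where import Data.Unit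
  x ⊨ ⋀ I φs   = ∀ (i : I) → x ⊨ φs i
  x ⊨ (⟨ a ⟩ φ) = Σ PState (λ x' → (x ⇒[ a ] x') × (x' ⊨ φ))
  x ⊨ ¬' φ     = ¬ (x ⊨ φ)

module Submission where

-- The projection π n s behaves like s for n steps and then
-- stops; cut n φ does the same to a formula, replacing every modality nested
-- below depth n by F.  The link between the two is an inversion of the
-- transition rules for projected states:
--   * π 0 x has no transitions, and
--   * the a-successors of π (n+1) x are exactly the states π n x' with
--     x ⇒[ a ] x'.
-- The theorem is proved directly as an equivalence, by structural induction
-- on φ with n and s arbitrary.  Satisfaction of ⋀ and ¬ respects equivalence
-- of the components (congruence lemmas below), so the only interesting case
-- is the modality ⟨ a ⟩: for n = 0 both sides are unsatisfiable, and for
-- n + 1 the inversion turns an a-step of π (n+1) s into a projected a-step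
-- of s and back.

open import Defs
open import Level using (Level; lift)
open import Data.Nat using (ℕ; zero; suc)
open import Data.Product using (_,_)
open import Relation.Nullary using (¬_)
open import Data.Empty using (⊥-elim)
open import Function.Bundles using (_⇔_; mk⇔; Equivalence)

module _ {ℓ : Level} (L : LTS ℓ) where
  open LTS L
  open ProjectionClosure L
  open Equivalence using (to; from)

  F-unsatisfiable : ∀ {ι} {x : PState} → ¬ (x ⊨ F {ι = ι})
  F-unsatisfiable ¬⊤ = ¬⊤ (lift _)

  -- π 0 x is deadlocked: its only candidate rule, `proj`, needs a
  -- projection index of the form n + 1.
  π-zero-deadlocked : ∀ {x a y} → ¬ (π zero x ⇒[ a ] y)
  π-zero-deadlocked ()

  ⟨⟩-π-zero : ∀ {ι} {x : PState} {a} {φ : HML ι Action} →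
              π zero x ⊨ (⟨ a ⟩ φ) ⇔ x ⊨ F {ι = ι}
  ⟨⟩-π-zero {ι} {x} =
    mk⇔ (λ { (_ , step , _) _ → π-zero-deadlocked step })
        (λ holds → ⊥-elim (F-unsatisfiable {ι} {x} holds))

  -- Modal step through a projection: the a-successors of π (n+1) x are the
  -- projections π n x' of the a-successors x' of x, so ⟨ a ⟩ commutes with
  -- projection, given the corresponding equivalence one step later.
  ⟨⟩-π-suc : ∀ {ι} {n x a} {φ ψ : HML ι Action} →
             (∀ x' → π n x' ⊨ φ ⇔ x' ⊨ ψ) →
             π (suc n) x ⊨ (⟨ a ⟩ φ) ⇔ x ⊨ (⟨ a ⟩ ψ)
  ⟨⟩-π-suc {n = n} φ⇔ψ =
    mk⇔ (λ { (_ , proj {x' = x'} step , holds) → x' , step , to (φ⇔ψ x') holds })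
        (λ { (x' , step , holds) → π n x' , proj step , from (φ⇔ψ x') holds })

  ⋀-cong : ∀ {ι} {x y : PState} {I} {φs ψs : I → HML ι Action} →
           (∀ i → x ⊨ φs i ⇔ y ⊨ ψs i) → x ⊨ ⋀ I φs ⇔ y ⊨ ⋀ I ψs
  ⋀-cong φs⇔ψs =
    mk⇔ (λ holds i → to (φs⇔ψs i) (holds i))
        (λ holds i → from (φs⇔ψs i) (holds i))

  ¬-cong : ∀ {ι} {x y : PState} {φ ψ : HML ι Action} →
           x ⊨ φ ⇔ y ⊨ ψ → x ⊨ ¬' φ ⇔ y ⊨ ¬' ψ
  ¬-cong φ⇔ψ =
    mk⇔ (λ ¬φ holds → ¬φ (from φ⇔ψ holds))
        (λ ¬ψ holds → ¬ψ (to φ⇔ψ holds))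

  -- The theorem, by induction on φ for arbitrary s and n; the modal case
  -- needs the induction hypothesis at every successor state s'.
  projection-cut : ∀ {ι} (s : PState) (φ : HML ι Action) (n : ℕ) →
                   π n s ⊨ φ ⇔ s ⊨ cut n φ
  projection-cut s T         n       = mk⇔ (λ t → t) (λ t → t)
  projection-cut s (⋀ I φs)  n       = ⋀-cong (λ i → projection-cut s (φs i) n)
  projection-cut s (⟨ a ⟩ φ) zero    = ⟨⟩-π-zero {φ = φ}
  projection-cut s (⟨ a ⟩ φ) (suc n) = ⟨⟩-π-suc (λ s' → projection-cut s' φ n)
  projection-cut s (¬' φ)    n       = ¬-cong (projection-cut s φ n)

lemma10 : ∀ {ℓ ι : Level} (L : LTS ℓ) (s : ProjectionClosure.PState L)
    (φ : HML ι (LTS.Action L)) (n : ℕ) →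
    ProjectionClosure._⊨_ L (ProjectionClosure.π n s) φ
    ⇔ ProjectionClosure._⊨_ L s (cut n φ)
lemma10 L = projection-cut L
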